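{- Let $n\ge1$. The set of Carter diagrams of type $A_n$ is the set $\mathcal{A}^{n,n}$ of Kluitmann diagrams of tuples $(t_1,\dots,t_n)$ of transpositions in $\mathrm{Sym}([n+1])$ with $\langle t_1,\dots,t_n\rangle=\mathrm{Sym}([n+1])$.
   Context: The Weyl group of type $A_n$ is identified with $\mathrm{Sym}([n+1])$, its reflections with the transpositions. The Kluitmann diagram of a tuple $(t_1,\dots,t_m)$ of transpositions has vertices corresponding to $t_1,\dots,t_m$, two vertices $t_i,t_j$ being joined by an edge iff $t_it_j\ne t_jt_i$. A Carter diagram (for a crystallographic root system $\Phi$ and linearly independent roots $\beta_1,\dots,\beta_m$) has vertices $\beta_i$ with distinct $\beta_i,\beta_j$ joined by $\frac{2(\beta_i\mid\beta_j)}{(\beta_i\mid\beta_i)}\cdot\frac{2(\beta_j\mid\beta_i)}{(\beta_j\mid\beta_j)}$ edges; its type is the Dynkin type of the smallest root subsystem containing the $\beta_i$. -}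

module Defs where

open import Data.Nat using (ℕ; zero; suc)
open import Data.Fin using (Fin; zero; suc; _≟_)
open import Data.Fin.Permutation using (Permutation′; transpose; _⟨$⟩ʳ_)
open import Data.Integer using (ℤ; +_; _+_; _-_; _*_; 0ℤ; 1ℤ)
open import Data.List using (List; []; _∷_)
open import Data.Product using (Σ; ∃; _×_; Σ-syntax; ∃-syntax)
open import Data.Sum using (_⊎_)
open import Data.Bool using (if_then_else_)
open import Relation.Nullary using (¬_)
open import Relation.Nullary.Decidable using (⌊_⌋)
open import Relation.Binary.PropositionalEquality using (_≡_; _≢_)

Vec' : ℕ → Set
Vec' k = Fin k → ℤ

e : ∀ {k} → Fin k → Vec' k
e i x = if ⌊ i ≟ x ⌋ then 1ℤ else 0ℤ

⟨_,_⟩ : ∀ {k} → Vec' k → Vec' k → ℤ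
⟨_,_⟩ {zero}  u v = 0ℤ
⟨_,_⟩ {suc k} u v = u zero * v zero + ⟨ (λ x → u (suc x)) , (λ x → v (suc x)) ⟩

IsRoot : ∀ {k} → Vec' k → Set
IsRoot {k} v = Σ[ i ∈ Fin k ] Σ[ j ∈ Fin k ] (i ≢ j × (∀ x → v x ≡ e i x - e j x))

Σℤ : ∀ {m} → (Fin m → ℤ) → ℤ
Σℤ {zero}  f = 0ℤ
Σℤ {suc m} f = f zero + Σℤ (λ i → f (suc i))

-- linear independence of a family of integer vectors (over ℤ, equivalently ℚ)
LinIndep : ∀ {m k} → (Fin m → Vec' k) → Set
LinIndep {m} {k} β =
  (c : Fin m → ℤ) → (∀ x → Σℤ (λ i → c i * β i x) ≡ 0ℤ) → ∀ i → c i ≡ 0ℤ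

-- a root subsystem: a set of roots closed under all reflections
-- s_α(β) = β - (2(β|α)/(α|α)) α ; the reflected vector γ is characterised
-- by (α|α) γ = (α|α) β - 2 (β|α) α  (note (α|α) ≠ 0 for roots).
IsRootSubsystem : ∀ {k} → (Vec' k → Set) → Set
IsRootSubsystem {k} S =
  (∀ v → S v → IsRoot v) ×
  (∀ α β γ → S α → S β →
     (∀ x → ⟨ α , α ⟩ * γ x ≡ ⟨ α , α ⟩ * β x - (+ 2) * ⟨ β , α ⟩ * α x) →
     S γ)

GeneratesΦ : ∀ {m k} → (Fin m → Vec' k) → Set₁
GeneratesΦ {m} {k} β =
  (S : Vec' k → Set) → IsRootSubsystem S → (∀ i → S (β i)) →
  ∀ v → IsRoot v → S v

-- G (a multigraph on the vertex set Fin m, given by edge multiplicities)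
-- is the Carter diagram of β: distinct β_i, β_j are joined by
-- (2(β_i|β_j)/(β_i|β_i)) · (2(β_j|β_i)/(β_j|β_j)) edges, no loops.
IsCarterDiagramOf : ∀ {m k} → (Fin m → Vec' k) → (Fin m → Fin m → ℕ) → Set
IsCarterDiagramOf β G =
  ∀ i j → (i ≡ j × G i j ≡ 0) ⊎
          (i ≢ j × ((+ G i j) * (⟨ β i , β i ⟩ * ⟨ β j , β j ⟩)
                     ≡ ((+ 2) * ⟨ β i , β j ⟩) * ((+ 2) * ⟨ β j , β i ⟩)))

CarterDiagramA : (n : ℕ) → (Fin n → Fin n → ℕ) → Set₁
CarterDiagramA n G =
  Σ[ β ∈ (Fin n → Vec' (suc n)) ]
    ((∀ i → IsRoot (β i)) × LinIndep β × GeneratesΦ β × IsCarterDiagramOf β G)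

record Transposition (k : ℕ) : Set where
  constructor tr
  field
    a b : Fin k
    a≢b : a ≢ b

perm : ∀ {k} → Transposition k → Permutation′ k
perm (tr a b _) = transpose a b

evalWord : ∀ {m k} → (Fin m → Transposition k) → List (Fin m) → Fin k → Fin k
evalWord ts []      x = x
evalWord ts (w ∷ ws) x = perm (ts w) ⟨$⟩ʳ evalWord ts ws x

-- ⟨t_1,…,t_m⟩ = Sym(Fin k): every permutation is a product of the t_i
-- (in a finite group the generated submonoid is the generated subgroup)
GeneratesSym : ∀ {m k} → (Fin m → Transposition k) → Set
GeneratesSym {m} {k} ts =
  (σ : Permutation′ k) → Σ[ w ∈ List (Fin m) ] (∀ x → evalWord ts w x ≡ σ ⟨$⟩ʳ x)

Commute : ∀ {k} → Transposition k → Transposition k → Set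
Commute s t = ∀ x → perm s ⟨$⟩ʳ (perm t ⟨$⟩ʳ x) ≡ perm t ⟨$⟩ʳ (perm s ⟨$⟩ʳ x)

IsKluitmannDiagramOf : ∀ {m k} → (Fin m → Transposition k) → (Fin m → Fin m → ℕ) → Set
IsKluitmannDiagramOf ts G =
  ∀ i j → (¬ Commute (ts i) (ts j) × G i j ≡ 1) ⊎ (Commute (ts i) (ts j) × G i j ≡ 0)

InAnn : (n : ℕ) → (Fin n → Fin n → ℕ) → Set
InAnn n G =
  Σ[ ts ∈ (Fin n → Transposition (suc n)) ] (GeneratesSym ts × IsKluitmannDiagramOf ts G)

-- Every root of A_n is e_a − e_b, and reflecting e_x − e_y in e_a − e_b gives e_{τx} − e_{τy} for the
-- transposition τ = (a b). So roots are transpositions and reflections are conjugations; two distinct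
-- roots are orthogonal exactly when their transpositions commute, and otherwise have inner product ±1,
-- which makes the Carter and Kluitmann diagrams coincide. The β_i generate Φ iff the t_i generate
-- Sym([n+1]): the roots whose transposition is a word in the t_i form a root subsystem, and conversely
-- words in the t_i act 2-transitively on indices and carry any β_i (here n ≥ 1 is used) to every root.
-- Finally n transpositions generating Sym([n+1]) are the edges of a spanning tree on n+1 points, and
-- the roots of the edges of a tree are linearly independent.

module Submission where

open import Defs
open import Data.Nat using (ℕ; _≤_)
open import Data.Fin using (Fin)
open import Function.Bundles using (_⇔_; mk⇔; Equivalence)

open import Data.Empty using (⊥-elim)
open import Data.Fin using (zero; suc; _≟_; punchOut; fromℕ<)
open import Data.Fin.Properties using (suc-injective; any?; injective⇒≤; punchOut-injective)
open import Data.Fin.Permutation using (Permutation′; _⟨$⟩ʳ_; transpose; _∘ₚ_)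
open import Data.Fin.Permutation.Components using () renaming (transpose to τ)
open import Data.Fin.Permutation.Transposition.List using (TranspositionList; eval; decompose; eval-decompose)
open import Data.Integer using (ℤ; +_; -[1+_]; 0ℤ; 1ℤ; _+_; _-_; _*_)
import Data.Integer.Properties as ℤ
open import Data.Integer.Tactic.RingSolver using (solve-∀)
open import Data.List using (List; []; _∷_; _++_; length)
open import Data.Nat using (zero; suc; _<_; _⊔_; _∸_; s≤s)
open import Data.Nat.Induction using (<-wellFounded)
import Data.Nat.Properties as ℕ
open import Data.Product using (Σ-syntax; _×_; _,_; proj₁; proj₂)
open import Data.Sum using (_⊎_; inj₁; inj₂; [_,_])
open import Function using (id; _∘_; case_of_)
open import Function.Properties.Equivalence using () renaming (trans to ⇔-trans)
open import Induction.WellFounded using (Acc; acc)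
open import Relation.Binary.PropositionalEquality
  using (_≡_; _≢_; _≗_; refl; sym; trans; cong; cong₂; subst; module ≡-Reasoning)
open import Relation.Nullary using (¬_; Dec; yes; no)
open import Relation.Nullary.Decidable using (dec-true; dec-false; _×-dec_; _⊎-dec_)
open import Relation.Unary using (Decidable)

private
  variable
    k m : ℕ

e-diagonal : (i : Fin k) → e i i ≡ 1ℤ
e-diagonal i with i ≟ i
... | yes _   = refl
... | no i≢i = ⊥-elim (i≢i refl)

e-offDiagonal : {i x : Fin k} → i ≢ x → e i x ≡ 0ℤ
e-offDiagonal {i = i} {x} i≢x with i ≟ x
... | yes i≡x = ⊥-elim (i≢x i≡x)
... | no _    = refl

Σℤ-cong : {f g : Fin m → ℤ} → f ≗ g → Σℤ f ≡ Σℤ g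
Σℤ-cong {zero}  f≗g = refl
Σℤ-cong {suc m} f≗g = cong₂ _+_ (f≗g zero) (Σℤ-cong (f≗g ∘ suc))

Σℤ-zero : {f : Fin m → ℤ} → (∀ i → f i ≡ 0ℤ) → Σℤ f ≡ 0ℤ
Σℤ-zero {zero}  f≡0 = refl
Σℤ-zero {suc m} f≡0 = cong₂ _+_ (f≡0 zero) (Σℤ-zero (f≡0 ∘ suc))

Σℤ-single : (f : Fin m → ℤ) (i : Fin m) → (∀ j → j ≢ i → f j ≡ 0ℤ) → Σℤ f ≡ f i
Σℤ-single f zero    f≡0 = trans (cong (_+_ (f zero)) (Σℤ-zero (λ j → f≡0 (suc j) λ ()))) (ℤ.+-identityʳ _)
Σℤ-single f (suc i) f≡0 =
  trans (cong₂ _+_ (f≡0 zero λ ()) (Σℤ-single (f ∘ suc) i λ j j≢i → f≡0 (suc j) (j≢i ∘ suc-injective)))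
        (ℤ.+-identityˡ _)

Σℤ-+-* : (f g : Fin m → ℤ) (s : ℤ) → Σℤ (λ i → f i + s * g i) ≡ Σℤ f + s * Σℤ g
Σℤ-+-* {zero}  f g s = sym (trans (ℤ.+-identityˡ (s * 0ℤ)) (ℤ.*-zeroʳ s))
Σℤ-+-* {suc m} f g s =
  trans (cong (_+_ (f zero + s * g zero)) (Σℤ-+-* (f ∘ suc) (g ∘ suc) s))
        (regroup (f zero) (g zero) (Σℤ (f ∘ suc)) (Σℤ (g ∘ suc)) s)
  where
  regroup : ∀ a b c d s → (a + s * b) + (c + s * d) ≡ (a + c) + s * (b + d)
  regroup = solve-∀

Σℤ-sift : (f : Fin m → ℤ) (i : Fin m) → Σℤ (λ x → f x * e i x) ≡ f i
Σℤ-sift f i = trans (Σℤ-single _ i λ j j≢i → trans (cong (f j *_) (e-offDiagonal (j≢i ∘ sym))) (ℤ.*-zeroʳ (f j)))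
                    (trans (cong (f i *_) (e-diagonal i)) (ℤ.*-identityʳ (f i)))

⟨⟩-Σℤ : (u v : Vec' k) → ⟨ u , v ⟩ ≡ Σℤ (λ x → u x * v x)
⟨⟩-Σℤ {zero}  u v = refl
⟨⟩-Σℤ {suc k} u v = cong (_+_ (u zero * v zero)) (⟨⟩-Σℤ (u ∘ suc) (v ∘ suc))

⟨⟩-cong : {u u′ v v′ : Vec' k} → u ≗ u′ → v ≗ v′ → ⟨ u , v ⟩ ≡ ⟨ u′ , v′ ⟩
⟨⟩-cong {u = u} {u′} {v} {v′} u≗u′ v≗v′ =
  trans (⟨⟩-Σℤ u v) (trans (Σℤ-cong λ x → cong₂ _*_ (u≗u′ x) (v≗v′ x)) (sym (⟨⟩-Σℤ u′ v′)))

⟨⟩-sym : (u v : Vec' k) → ⟨ u , v ⟩ ≡ ⟨ v , u ⟩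
⟨⟩-sym u v = trans (⟨⟩-Σℤ u v) (trans (Σℤ-cong λ x → ℤ.*-comm (u x) (v x)) (sym (⟨⟩-Σℤ v u)))

unit-cancel : {c w : ℤ} → w * w ≡ 1ℤ → c * w ≡ 0ℤ → c ≡ 0ℤ
unit-cancel {c} {w} w²≡1 cw≡0 = begin
  c            ≡⟨ sym (ℤ.*-identityʳ c) ⟩
  c * 1ℤ       ≡⟨ cong (c *_) (sym w²≡1) ⟩
  c * (w * w)  ≡⟨ sym (ℤ.*-assoc c w w) ⟩
  c * w * w    ≡⟨ cong (_* w) cw≡0 ⟩
  0ℤ * w       ≡⟨ ℤ.*-zeroˡ w ⟩
  0ℤ           ∎
  where open ≡-Reasoning

-- Roots and transpositions

ρ : Fin k → Fin k → Vec' k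
ρ a b x = e a x - e b x

root : Transposition k → Vec' k
root t = ρ (Transposition.a t) (Transposition.b t)

root-isRoot : (t : Transposition k) → IsRoot (root t)
root-isRoot (tr a b a≢b) = a , b , a≢b , λ _ → refl

transposition : {v : Vec' k} → IsRoot v → Transposition k
transposition (a , b , a≢b , _) = tr a b a≢b

≗root-transposition : {v : Vec' k} (r : IsRoot v) → v ≗ root (transposition r)
≗root-transposition (_ , _ , _ , v≗ρab) = v≗ρab

⟨⟩-ρ : (u : Vec' k) (a b : Fin k) → ⟨ u , ρ a b ⟩ ≡ u a - u b
⟨⟩-ρ u a b = begin
  ⟨ u , ρ a b ⟩                                        ≡⟨ ⟨⟩-Σℤ u (ρ a b) ⟩
  Σℤ (λ x → u x * (e a x - e b x))                     ≡⟨ Σℤ-cong (λ x → split (u x) (e a x) (e b x)) ⟩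
  Σℤ (λ x → u x * e a x + -[1+ 0 ] * (u x * e b x))    ≡⟨ Σℤ-+-* (λ x → u x * e a x) (λ x → u x * e b x) -[1+ 0 ] ⟩
  Σℤ (λ x → u x * e a x) + -[1+ 0 ] * Σℤ (λ x → u x * e b x)
                                                       ≡⟨ cong₂ (λ p q → p + -[1+ 0 ] * q) (Σℤ-sift u a) (Σℤ-sift u b) ⟩
  u a + -[1+ 0 ] * u b                                 ≡⟨ merge (u a) (u b) ⟩
  u a - u b                                            ∎
  where
  open ≡-Reasoning
  split : ∀ p q r → p * (q - r) ≡ p * q + -[1+ 0 ] * (p * r)
  split = solve-∀
  merge : ∀ p q → p + -[1+ 0 ] * q ≡ p - q
  merge = solve-∀

ρ-norm : {a b : Fin k} → a ≢ b → ⟨ ρ a b , ρ a b ⟩ ≡ + 2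
ρ-norm {a = a} {b} a≢b
  rewrite ⟨⟩-ρ (ρ a b) a b | e-diagonal a | e-diagonal b | e-offDiagonal a≢b | e-offDiagonal (a≢b ∘ sym) = refl

ρ≡1⇒left : {x y z : Fin k} → ρ x y z ≡ 1ℤ → x ≡ z
ρ≡1⇒left {x = x} {y} {z} ρ≡1 with x ≟ z | y ≟ z
... | yes x≡z | _     = x≡z
... | no _    | yes _ = case ρ≡1 of λ ()
... | no _    | no _  = case ρ≡1 of λ ()

ρ≡-1⇒right : {x y z : Fin k} → ρ x y z ≡ -[1+ 0 ] → y ≡ z
ρ≡-1⇒right {x = x} {y} {z} ρ≡-1 with x ≟ z | y ≟ z
... | _     | yes y≡z = y≡z
... | yes _ | no _    = case ρ≡-1 of λ ()
... | no _  | no _    = case ρ≡-1 of λ ()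

ρ-injective : {a b x y : Fin k} → a ≢ b → ρ a b ≗ ρ x y → x ≡ a × y ≡ b
ρ-injective {a = a} {b} {x} {y} a≢b ρab≗ρxy =
  ρ≡1⇒left {y = y} (trans (sym (ρab≗ρxy a)) (cong₂ _-_ (e-diagonal a) (e-offDiagonal (a≢b ∘ sym)))) ,
  ρ≡-1⇒right {x = x} (trans (sym (ρab≗ρxy b)) (cong₂ _-_ (e-offDiagonal a≢b) (e-diagonal b)))

data Position {k} (a b : Fin k) : Fin k → Set where
  at-a      : Position a b a
  at-b      : b ≢ a → Position a b b
  elsewhere : ∀ {x} → x ≢ a → x ≢ b → Position a b x

position : (a b x : Fin k) → Position a b x
position a b x with x ≟ a | x ≟ b
... | yes refl | _        = at-a
... | no x≢a   | yes refl = at-b x≢a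
... | no x≢a   | no x≢b   = elsewhere x≢a x≢b

τ-left : (a b : Fin k) → τ a b a ≡ b
τ-left a b rewrite dec-true (a ≟ a) refl = refl

τ-right : (a b : Fin k) → τ a b b ≡ a
τ-right a b with a ≟ b
... | yes refl rewrite dec-true (a ≟ a) refl = refl
... | no a≢b rewrite dec-false (b ≟ a) (a≢b ∘ sym) | dec-true (b ≟ b) refl = refl

τ-other : {a b x : Fin k} → x ≢ a → x ≢ b → τ a b x ≡ x
τ-other {a = a} {b} {x} x≢a x≢b rewrite dec-false (x ≟ a) x≢a | dec-false (x ≟ b) x≢b = refl

τ-diagonal : (a x : Fin k) → τ a a x ≡ x
τ-diagonal a x with position a a x
... | at-a            = τ-left a a
... | at-b a≢a        = ⊥-elim (a≢a refl)
... | elsewhere x≢a _ = τ-other x≢a x≢a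

τ-involutive : (a b x : Fin k) → τ a b (τ a b x) ≡ x
τ-involutive a b x with position a b x
... | at-a              rewrite τ-left a b  = τ-right a b
... | at-b _            rewrite τ-right a b = τ-left a b
... | elsewhere x≢a x≢b rewrite τ-other x≢a x≢b = τ-other x≢a x≢b

τ-injective : (a b : Fin k) {x y : Fin k} → τ a b x ≡ τ a b y → x ≡ y
τ-injective a b {x} {y} eq = trans (sym (τ-involutive a b x)) (trans (cong (τ a b) eq) (τ-involutive a b y))

τ-conjugate : (a b x y z : Fin k) → τ a b (τ x y (τ a b z)) ≡ τ (τ a b x) (τ a b y) z
τ-conjugate a b x y z = trans (τ-equivariant (τ a b z)) (cong (τ (τ a b x) (τ a b y)) (τ-involutive a b z))
  where
  τ-equivariant : ∀ w → τ a b (τ x y w) ≡ τ (τ a b x) (τ a b y) (τ a b w)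
  τ-equivariant w with position x y w
  ... | at-a rewrite τ-left x y = sym (τ-left (τ a b x) (τ a b y))
  ... | at-b _ rewrite τ-right x y = sym (τ-right (τ a b x) (τ a b y))
  ... | elsewhere w≢x w≢y rewrite τ-other w≢x w≢y =
    sym (τ-other (w≢x ∘ τ-injective a b) (w≢y ∘ τ-injective a b))

ReflectionOf : Vec' k → Vec' k → Vec' k → Set
ReflectionOf α β γ = ∀ x → ⟨ α , α ⟩ * γ x ≡ ⟨ α , α ⟩ * β x - (+ 2) * ⟨ β , α ⟩ * α x

e-τ : {a b : Fin k} → a ≢ b → (x z : Fin k) → e (τ a b x) z ≡ e x z - (e x a - e x b) * ρ a b z
e-τ {a = a} {b} a≢b x z with position a b x
... | at-a rewrite τ-left a b | e-diagonal a | e-offDiagonal a≢b = shift (e a z) (e b z)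
  where
  shift : ∀ p q → q ≡ p - (1ℤ - 0ℤ) * (p - q)
  shift = solve-∀
... | at-b b≢a rewrite τ-right a b | e-diagonal b | e-offDiagonal b≢a = shift (e a z) (e b z)
  where
  shift : ∀ p q → p ≡ q - (0ℤ - 1ℤ) * (p - q)
  shift = solve-∀
... | elsewhere x≢a x≢b rewrite τ-other x≢a x≢b | e-offDiagonal x≢a | e-offDiagonal x≢b =
  shift (e x z) (ρ a b z)
  where
  shift : ∀ p q → p ≡ p - (0ℤ - 0ℤ) * q
  shift = solve-∀

ρ-τ : {a b : Fin k} → a ≢ b → (x y z : Fin k) →
      ρ (τ a b x) (τ a b y) z ≡ ρ x y z - ⟨ ρ x y , ρ a b ⟩ * ρ a b z
ρ-τ {a = a} {b} a≢b x y z rewrite e-τ a≢b x z | e-τ a≢b y z | ⟨⟩-ρ (ρ x y) a b =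
  regroup (e x z) (e y z) (e x a) (e x b) (e y a) (e y b) (ρ a b z)
  where
  regroup : ∀ p q r s t u w → (p - (r - s) * w) - (q - (t - u) * w) ≡ (p - q) - ((r - t) - (s - u)) * w
  regroup = solve-∀

reflection-ρ : {α β γ : Vec' k} {a b : Fin k} (x y : Fin k) → a ≢ b → α ≗ ρ a b → β ≗ ρ x y →
               ReflectionOf α β γ ⇔ γ ≗ ρ (τ a b x) (τ a b y)
reflection-ρ {α = α} {β} {γ} {a} {b} x y a≢b α≗ρab β≗ρxy =
  mk⇔ (λ refl-eq z → ℤ.*-cancelˡ-≡ (+ 2) (γ z) _ (trans (sym (lhs z)) (trans (refl-eq z) (rhs z))))
      (λ γ≗ z → trans (lhs z) (trans (cong (+ 2 *_) (γ≗ z)) (sym (rhs z))))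
  where
  open ≡-Reasoning
  ⟨α,α⟩≡2 : ⟨ α , α ⟩ ≡ + 2
  ⟨α,α⟩≡2 = trans (⟨⟩-cong α≗ρab α≗ρab) (ρ-norm a≢b)
  lhs : ∀ z → ⟨ α , α ⟩ * γ z ≡ + 2 * γ z
  lhs z = cong (_* γ z) ⟨α,α⟩≡2
  rhs : ∀ z → ⟨ α , α ⟩ * β z - + 2 * ⟨ β , α ⟩ * α z ≡ + 2 * ρ (τ a b x) (τ a b y) z
  rhs z = begin
    ⟨ α , α ⟩ * β z - + 2 * ⟨ β , α ⟩ * α z
      ≡⟨ cong₂ (λ p q → p * β z - + 2 * q * α z) ⟨α,α⟩≡2 (⟨⟩-cong β≗ρxy α≗ρab) ⟩
    + 2 * β z - + 2 * ⟨ ρ x y , ρ a b ⟩ * α z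
      ≡⟨ cong₂ (λ p q → + 2 * p - + 2 * ⟨ ρ x y , ρ a b ⟩ * q) (β≗ρxy z) (α≗ρab z) ⟩
    + 2 * ρ x y z - + 2 * ⟨ ρ x y , ρ a b ⟩ * ρ a b z
      ≡⟨ factor (ρ x y z) ⟨ ρ x y , ρ a b ⟩ (ρ a b z) ⟩
    + 2 * (ρ x y z - ⟨ ρ x y , ρ a b ⟩ * ρ a b z)
      ≡⟨ cong (+ 2 *_) (sym (ρ-τ a≢b x y z)) ⟩
    + 2 * ρ (τ a b x) (τ a b y) z ∎
    where
    factor : ∀ p q r → + 2 * p - + 2 * q * r ≡ + 2 * (p - q * r)
    factor = solve-∀

ρ-reflects : {a b : Fin k} → a ≢ b → (x y : Fin k) → ReflectionOf (ρ a b) (ρ x y) (ρ (τ a b x) (τ a b y))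
ρ-reflects a≢b x y = Equivalence.from (reflection-ρ x y a≢b (λ _ → refl) (λ _ → refl)) (λ _ → refl)

-- Generating Φ versus generating Sym([n+1])

IsWord : (Fin m → Transposition k) → (Fin k → Fin k) → Set
IsWord {m} ts f = Σ[ w ∈ List (Fin m) ] evalWord ts w ≗ f

module _ (ts : Fin m → Transposition k) where

  evalWord-++ : (w v : List (Fin m)) → evalWord ts (w ++ v) ≗ evalWord ts w ∘ evalWord ts v
  evalWord-++ []      v x = refl
  evalWord-++ (i ∷ w) v x = cong (perm (ts i) ⟨$⟩ʳ_) (evalWord-++ w v x)

  word-id : IsWord ts id
  word-id = [] , λ _ → refl

  word-∘ : {f g : Fin k → Fin k} → IsWord ts f → IsWord ts g → IsWord ts (f ∘ g)
  word-∘ {f} (w , w≗f) (v , v≗g) = w ++ v , λ x → trans (evalWord-++ w v x) (trans (w≗f _) (cong f (v≗g x)))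

  word-cong : {f g : Fin k → Fin k} → f ≗ g → IsWord ts f → IsWord ts g
  word-cong f≗g (w , w≗f) = w , λ x → trans (w≗f x) (f≗g x)

  word-generator : (i : Fin m) → IsWord ts (τ (Transposition.a (ts i)) (Transposition.b (ts i)))
  word-generator i = i ∷ [] , λ _ → refl

  transpositionWords⇒generatesSym : (∀ a b → IsWord ts (τ a b)) → GeneratesSym ts
  transpositionWords⇒generatesSym words σ = word-cong (eval-decompose σ) (evalWord-list (decompose σ))
    where
    evalWord-list : (xs : TranspositionList k) → IsWord ts (eval xs ⟨$⟩ʳ_)
    evalWord-list []             = word-id
    evalWord-list ((i , j) ∷ xs) = word-∘ (evalWord-list xs) (words i j)

module _ (ts : Fin m → Transposition k) where

  WordRoot : Vec' k → Set
  WordRoot v = Σ[ x ∈ Fin k ] Σ[ y ∈ Fin k ] (x ≢ y × v ≗ ρ x y × IsWord ts (τ x y))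

  wordRoots-rootSubsystem : IsRootSubsystem WordRoot
  wordRoots-rootSubsystem = (λ { v (x , y , x≢y , v≗ρxy , _) → x , y , x≢y , v≗ρxy }) , reflect
    where
    reflect : ∀ α β γ → WordRoot α → WordRoot β → ReflectionOf α β γ → WordRoot γ
    reflect α β γ (a , b , a≢b , α≗ρab , word-ab) (x , y , x≢y , β≗ρxy , word-xy) γ-reflects =
      τ a b x , τ a b y , x≢y ∘ τ-injective a b ,
      Equivalence.to (reflection-ρ x y a≢b α≗ρab β≗ρxy) γ-reflects ,
      word-cong ts (τ-conjugate a b x y) (word-∘ ts word-ab (word-∘ ts word-xy word-ab))

  generatesΦ⇒generatesSym : (β : Fin m → Vec' k) → (∀ i → β i ≗ root (ts i)) → GeneratesΦ β → GeneratesSym ts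
  generatesΦ⇒generatesSym β β≗root genΦ = transpositionWords⇒generatesSym ts word-τ
    where
    generator-wordRoot : ∀ i → WordRoot (β i)
    generator-wordRoot i = a , b , a≢b , β≗root i , word-generator ts i
      where open Transposition (ts i)
    word-τ : ∀ a b → IsWord ts (τ a b)
    word-τ a b with a ≟ b
    ... | yes refl = word-cong ts (sym ∘ τ-diagonal a) (word-id ts)
    ... | no a≢b with genΦ WordRoot wordRoots-rootSubsystem generator-wordRoot (ρ a b) (a , b , a≢b , λ _ → refl)
    ...   | x , y , _ , ρab≗ρxy , word-xy with ρ-injective {x = x} {y} a≢b ρab≗ρxy
    ...     | refl , refl = word-xy

permutation-sending : {p q a b : Fin k} → p ≢ q → a ≢ b → Σ[ σ ∈ Permutation′ k ] (σ ⟨$⟩ʳ p ≡ a × σ ⟨$⟩ʳ q ≡ b)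
permutation-sending {p = p} {q} {a} {b} p≢q a≢b = transpose p a ∘ₚ transpose q′ b , σp≡a , τ-left q′ b
  where
  q′ = τ p a q
  a≢q′ : a ≢ q′
  a≢q′ a≡q′ = p≢q (τ-injective p a (trans (τ-left p a) a≡q′))
  σp≡a : τ q′ b (τ p a p) ≡ a
  σp≡a = trans (cong (τ q′ b) (τ-left p a)) (τ-other a≢q′ a≢b)

module _ (ts : Fin m → Transposition k) {S : Vec' k → Set}
         (S-subsystem : IsRootSubsystem S) (S∋generator : ∀ i → S (root (ts i))) where

  rootSubsystem-evalWord : {x y : Fin k} → S (ρ x y) → ∀ w → S (ρ (evalWord ts w x) (evalWord ts w y))
  rootSubsystem-evalWord S∋ρxy []      = S∋ρxy
  rootSubsystem-evalWord {x} {y} S∋ρxy (i ∷ w) =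
    proj₂ S-subsystem _ _ _ (S∋generator i) (rootSubsystem-evalWord S∋ρxy w)
      (ρ-reflects a≢b (evalWord ts w x) (evalWord ts w y))
    where open Transposition (ts i)

  -- Words act 2-transitively on indices, so they carry the root of one generator to every root.
  rootSubsystem-full : Fin m → GeneratesSym ts → ∀ v → IsRoot v → S v
  rootSubsystem-full i₀ gen v (a , b , a≢b , v≗ρab) =
    proj₂ S-subsystem _ _ v (S∋ρ a≢b) (S∋ρ (a≢b ∘ sym))
      (Equivalence.from (reflection-ρ b a a≢b (λ _ → refl) (λ _ → refl))
        (λ z → trans (v≗ρab z) (cong₂ (λ p q → ρ p q z) (sym (τ-right a b)) (sym (τ-left a b)))))
    where
    S∋ρ : ∀ {x y} → x ≢ y → S (ρ x y)
    S∋ρ x≢y with permutation-sending (Transposition.a≢b (ts i₀)) x≢y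
    ... | σ , σa≡x , σb≡y with gen σ
    ...   | w , w≗σ = subst S (cong₂ ρ (trans (w≗σ _) σa≡x) (trans (w≗σ _) σb≡y))
                            (rootSubsystem-evalWord (S∋generator i₀) w)

generatesSym⇒generatesΦ : (ts : Fin m → Transposition k) → Fin m → GeneratesSym ts → GeneratesΦ (root ∘ ts)
generatesSym⇒generatesΦ ts i₀ gen S S-subsystem S∋generator = rootSubsystem-full ts S-subsystem S∋generator i₀ gen

-- Carter versus Kluitmann diagrams

SameSupport : Transposition k → Transposition k → Set
SameSupport (tr a b _) (tr c d _) = (a ≡ c × b ≡ d) ⊎ (a ≡ d × b ≡ c)

noncommuting : {a b c d q r : Fin k} (p : Fin k) → τ a b p ≡ q → τ a b r ≡ r → τ c d p ≡ r → τ c d q ≡ q → q ≢ r →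
               ¬ (∀ x → τ a b (τ c d x) ≡ τ c d (τ a b x))
noncommuting {a = a} {b} {c} {d} {q} {r} p sp sr tp tq q≢r comm = q≢r (begin
  q                 ≡⟨ sym tq ⟩
  τ c d q           ≡⟨ cong (τ c d) (sym sp) ⟩
  τ c d (τ a b p)   ≡⟨ sym (comm p) ⟩
  τ a b (τ c d p)   ≡⟨ cong (τ a b) tp ⟩
  τ a b r           ≡⟨ sr ⟩
  r                 ∎)
  where open ≡-Reasoning

disjoint-commute : {a b c d : Fin k} → a ≢ c → a ≢ d → b ≢ c → b ≢ d → ∀ x → τ a b (τ c d x) ≡ τ c d (τ a b x)
disjoint-commute {a = a} {b} {c} {d} a≢c a≢d b≢c b≢d x with position a b x | position c d x
... | at-a | _ rewrite τ-other a≢c a≢d | τ-left a b | τ-other b≢c b≢d = refl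
... | at-b _ | _ rewrite τ-other b≢c b≢d | τ-right a b | τ-other a≢c a≢d = refl
... | elsewhere x≢a x≢b | at-a rewrite τ-other x≢a x≢b | τ-left c d | τ-other (a≢d ∘ sym) (b≢d ∘ sym) = refl
... | elsewhere x≢a x≢b | at-b _ rewrite τ-other x≢a x≢b | τ-right c d | τ-other (a≢c ∘ sym) (b≢c ∘ sym) = refl
... | elsewhere x≢a x≢b | elsewhere x≢c x≢d rewrite τ-other x≢c x≢d | τ-other x≢a x≢b = sym (τ-other x≢c x≢d)

commute-or-meet : (s t : Transposition k) → ¬ SameSupport s t →
                  (Commute s t × ⟨ root s , root t ⟩ ≡ 0ℤ) ⊎
                  (¬ Commute s t × ⟨ root s , root t ⟩ * ⟨ root s , root t ⟩ ≡ 1ℤ)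
commute-or-meet (tr a b a≢b) (tr c d c≢d) ¬same with a ≟ c | a ≟ d | b ≟ c | b ≟ d
... | yes refl | _ | _ | _ =
  inj₂ (noncommuting a (τ-left a b) (τ-other (c≢d ∘ sym) (b≢d ∘ sym)) (τ-left a d) (τ-other (a≢b ∘ sym) b≢d) b≢d , value)
  where
  b≢d : b ≢ d
  b≢d b≡d = ¬same (inj₁ (refl , b≡d))
  value : ⟨ ρ a b , ρ a d ⟩ * ⟨ ρ a b , ρ a d ⟩ ≡ 1ℤ
  value rewrite ⟨⟩-ρ (ρ a b) a d | e-diagonal a | e-offDiagonal (a≢b ∘ sym) | e-offDiagonal c≢d | e-offDiagonal b≢d = refl
... | no a≢c | yes refl | _ | _ =
  inj₂ (noncommuting a (τ-left a b) (τ-other (a≢c ∘ sym) (b≢c ∘ sym)) (τ-right c a) (τ-other b≢c (a≢b ∘ sym)) b≢c , value)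
  where
  b≢c : b ≢ c
  b≢c b≡c = ¬same (inj₂ (refl , b≡c))
  value : ⟨ ρ a b , ρ c a ⟩ * ⟨ ρ a b , ρ c a ⟩ ≡ 1ℤ
  value rewrite ⟨⟩-ρ (ρ a b) c a | e-diagonal a | e-offDiagonal (a≢b ∘ sym) | e-offDiagonal a≢c | e-offDiagonal b≢c = refl
... | no a≢c | no a≢d | yes refl | _ =
  inj₂ (noncommuting b (τ-right a b) (τ-other (a≢d ∘ sym) (c≢d ∘ sym)) (τ-left b d) (τ-other a≢b a≢d) a≢d , value)
  where
  value : ⟨ ρ a b , ρ b d ⟩ * ⟨ ρ a b , ρ b d ⟩ ≡ 1ℤ
  value rewrite ⟨⟩-ρ (ρ a b) b d | e-diagonal b | e-offDiagonal a≢b | e-offDiagonal a≢d | e-offDiagonal c≢d = refl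
... | no a≢c | no a≢d | no b≢c | yes refl =
  inj₂ (noncommuting b (τ-right a b) (τ-other (a≢c ∘ sym) c≢d) (τ-right c b) (τ-other a≢c a≢b) a≢c , value)
  where
  value : ⟨ ρ a b , ρ c b ⟩ * ⟨ ρ a b , ρ c b ⟩ ≡ 1ℤ
  value rewrite ⟨⟩-ρ (ρ a b) c b | e-diagonal b | e-offDiagonal a≢b | e-offDiagonal a≢c | e-offDiagonal b≢c = refl
... | no a≢c | no a≢d | no b≢c | no b≢d = inj₁ (disjoint-commute a≢c a≢d b≢c b≢d , value)
  where
  value : ⟨ ρ a b , ρ c d ⟩ ≡ 0ℤ
  value rewrite ⟨⟩-ρ (ρ a b) c d | e-offDiagonal a≢c | e-offDiagonal a≢d | e-offDiagonal b≢c | e-offDiagonal b≢d = refl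

carter-edges : (g : ℕ) (w : ℤ) → (+ g * (+ 2 * + 2) ≡ (+ 2 * w) * (+ 2 * w)) ⇔ (+ g ≡ w * w)
carter-edges g w = mk⇔ (λ eq → ℤ.*-cancelʳ-≡ (+ g) (w * w) (+ 4) (trans eq (square w)))
                       (λ eq → trans (cong (_* (+ 4)) eq) (sym (square w)))
  where
  square : ∀ w → (+ 2 * w) * (+ 2 * w) ≡ w * w * + 4
  square = solve-∀

kluitmann-edges : {P : Set} {g : ℕ} {w : ℤ} → (P × w ≡ 0ℤ) ⊎ (¬ P × w * w ≡ 1ℤ) →
                  (+ g ≡ w * w) ⇔ ((¬ P × g ≡ 1) ⊎ (P × g ≡ 0))
kluitmann-edges (inj₁ (p , refl)) = mk⇔ (λ g≡0 → inj₂ (p , ℤ.+-injective g≡0))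
                                        λ { (inj₁ (¬p , _)) → ⊥-elim (¬p p) ; (inj₂ (_ , refl)) → refl }
kluitmann-edges (inj₂ (¬p , w²≡1)) = mk⇔ (λ g≡w² → inj₁ (¬p , ℤ.+-injective (trans g≡w² w²≡1)))
                                         λ { (inj₁ (_ , refl)) → sym w²≡1 ; (inj₂ (p , _)) → ⊥-elim (¬p p) }

CarterEdges : Vec' k → Vec' k → ℕ → Set
CarterEdges u v g = (+ g) * (⟨ u , u ⟩ * ⟨ v , v ⟩) ≡ ((+ 2) * ⟨ u , v ⟩) * ((+ 2) * ⟨ v , u ⟩)

KluitmannEdges : Transposition k → Transposition k → ℕ → Set
KluitmannEdges s t g = (¬ Commute s t × g ≡ 1) ⊎ (Commute s t × g ≡ 0)

edge-agreement : {u v : Vec' k} (s t : Transposition k) → u ≗ root s → v ≗ root t → ¬ SameSupport s t →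
                 (g : ℕ) → CarterEdges u v g ⇔ KluitmannEdges s t g
edge-agreement {u = u} {v} s t u≗s v≗t ¬same g
  rewrite ⟨⟩-sym v u | ⟨⟩-cong u≗s u≗s | ⟨⟩-cong v≗t v≗t | ⟨⟩-cong u≗s v≗t
        | ρ-norm (Transposition.a≢b s) | ρ-norm (Transposition.a≢b t) =
  ⇔-trans (carter-edges g ⟨ root s , root t ⟩) (kluitmann-edges (commute-or-meet s t ¬same))

linIndep-pair : (β : Fin m → Vec' k) → LinIndep β → {i j : Fin m} → i ≢ j → (s : ℤ) →
                ¬ (∀ x → β i x + s * β j x ≡ 0ℤ)
linIndep-pair β li {i} {j} i≢j s dependent = 1≢0 (li c combination i)
  where
  c : Fin _ → ℤ
  c l = e i l + s * e j l
  1≢0 : c i ≢ 0ℤ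
  1≢0 ci≡0 rewrite e-diagonal i | e-offDiagonal (i≢j ∘ sym) | ℤ.*-zeroʳ s = case ci≡0 of λ ()
  combination : ∀ x → Σℤ (λ l → c l * β l x) ≡ 0ℤ
  combination x = begin
    Σℤ (λ l → c l * β l x)                                          ≡⟨ Σℤ-cong (λ l → expand (e i l) (e j l) (β l x) s) ⟩
    Σℤ (λ l → β l x * e i l + s * (β l x * e j l))                  ≡⟨ Σℤ-+-* (λ l → β l x * e i l) (λ l → β l x * e j l) s ⟩
    Σℤ (λ l → β l x * e i l) + s * Σℤ (λ l → β l x * e j l)         ≡⟨ cong₂ (λ p q → p + s * q) (Σℤ-sift (λ l → β l x) i) (Σℤ-sift (λ l → β l x) j) ⟩
    β i x + s * β j x                                               ≡⟨ dependent x ⟩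
    0ℤ                                                              ∎
    where
    open ≡-Reasoning
    expand : ∀ p q r s → (p + s * q) * r ≡ r * p + s * (r * q)
    expand = solve-∀

linIndep⇒¬sameSupport : (β : Fin m → Vec' k) (ts : Fin m → Transposition k) → (∀ i → β i ≗ root (ts i)) →
                        LinIndep β → {i j : Fin m} → i ≢ j → ¬ SameSupport (ts i) (ts j)
linIndep⇒¬sameSupport β ts β≗root li {i} {j} i≢j = opposite (ts i) (ts j) (β≗root i) (β≗root j)
  where
  opposite : (s t : Transposition _) → β i ≗ root s → β j ≗ root t → ¬ SameSupport s t
  opposite (tr a b _) _ βi≗ρab βj≗ρab (inj₁ (refl , refl)) = linIndep-pair β li i≢j -[1+ 0 ] λ x →
    trans (cong₂ (λ p q → p + -[1+ 0 ] * q) (βi≗ρab x) (βj≗ρab x)) (cancel (e a x) (e b x))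
    where
    cancel : ∀ p q → (p - q) + -[1+ 0 ] * (p - q) ≡ 0ℤ
    cancel = solve-∀
  opposite (tr a b _) _ βi≗ρab βj≗ρba (inj₂ (refl , refl)) = linIndep-pair β li i≢j 1ℤ λ x →
    trans (cong₂ (λ p q → p + 1ℤ * q) (βi≗ρab x) (βj≗ρba x)) (cancel (e a x) (e b x))
    where
    cancel : ∀ p q → (p - q) + 1ℤ * (q - p) ≡ 0ℤ
    cancel = solve-∀

carter⇔kluitmann : (β : Fin m → Vec' k) (ts : Fin m → Transposition k) → (∀ i → β i ≗ root (ts i)) →
                   LinIndep β → (G : Fin m → Fin m → ℕ) → IsCarterDiagramOf β G ⇔ IsKluitmannDiagramOf ts G
carter⇔kluitmann β ts β≗root li G = mk⇔ carter⇒kluitmann kluitmann⇒carter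
  where
  agreement : ∀ {i j} → i ≢ j → CarterEdges (β i) (β j) (G i j) ⇔ KluitmannEdges (ts i) (ts j) (G i j)
  agreement {i} {j} i≢j =
    edge-agreement (ts i) (ts j) (β≗root i) (β≗root j) (linIndep⇒¬sameSupport β ts β≗root li i≢j) (G i j)
  carter⇒kluitmann : IsCarterDiagramOf β G → IsKluitmannDiagramOf ts G
  carter⇒kluitmann car i j with i ≟ j | car i j
  ... | yes refl | inj₁ (_ , g≡0)   = inj₂ ((λ _ → refl) , g≡0)
  ... | yes refl | inj₂ (i≢i , _)   = ⊥-elim (i≢i refl)
  ... | no i≢j   | inj₁ (i≡j , _)   = ⊥-elim (i≢j i≡j)
  ... | no i≢j   | inj₂ (_ , edges) = Equivalence.to (agreement i≢j) edges
  kluitmann⇒carter : IsKluitmannDiagramOf ts G → IsCarterDiagramOf β G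
  kluitmann⇒carter kl i j with i ≟ j | kl i j
  ... | yes refl | inj₁ (¬comm , _) = ⊥-elim (¬comm λ _ → refl)
  ... | yes refl | inj₂ (_ , g≡0)   = inj₁ (refl , g≡0)
  ... | no i≢j   | edges            = inj₂ (i≢j , Equivalence.from (agreement i≢j) edges)

-- Generating transpositions form a spanning tree

least-witness : {P : ℕ → Set} → Decidable P → {n : ℕ} → P n → Σ[ s ∈ ℕ ] (P s × (∀ {t} → t < s → ¬ P t))
least-witness {P} P? {n} Pn with search (suc n)
  where
  search : ∀ n → Σ[ s ∈ ℕ ] (P s × (∀ {t} → t < s → ¬ P t)) ⊎ (∀ {t} → t < n → ¬ P t)
  search zero = inj₂ λ ()
  search (suc n) with search n
  ... | inj₁ least = inj₁ least
  ... | inj₂ none with P? n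
  ...   | yes Pn = inj₁ (n , Pn , none)
  ...   | no ¬Pn = inj₂ λ t<1+n → [ none , (λ { refl → ¬Pn }) ] (ℕ.m<1+n⇒m<n∨m≡n t<1+n)
... | inj₁ least = least
... | inj₂ none  = ⊥-elim (none (ℕ.n<1+n n) Pn)

bounded : (f : Fin m → ℕ) → Σ[ b ∈ ℕ ] (∀ i → f i ≤ b)
bounded {zero}  f = 0 , λ ()
bounded {suc m} f with bounded (f ∘ suc)
... | b , f∘suc≤b = f zero ⊔ b , λ { zero    → ℕ.m≤m⊔n (f zero) b
                                   ; (suc i) → ℕ.≤-trans (f∘suc≤b i) (ℕ.m≤n⊔m (f zero) b) }

injective⇒surjective : (f : Fin m → Fin m) → (∀ {x y} → f x ≡ f y → x ≡ y) → ∀ y → Σ[ x ∈ Fin m ] f x ≡ y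
injective⇒surjective {suc m} f f-injective y with any? (λ x → f x ≟ y)
... | yes hit = hit
... | no miss = ⊥-elim (ℕ.<-irrefl refl (injective⇒≤ {f = f′} f′-injective))
  where
  f′ : Fin (suc m) → Fin m
  f′ x = punchOut {i = y} {j = f x} (λ y≡fx → miss (x , sym y≡fx))
  f′-injective : ∀ {x x′} → f′ x ≡ f′ x′ → x ≡ x′
  f′-injective {x} {x′} eq =
    f-injective (punchOut-injective {i = y} (λ y≡fx → miss (x , sym y≡fx)) (λ y≡fx′ → miss (x′ , sym y≡fx′)) eq)

module _ (ts : Fin m → Transposition (suc m)) (gen : GeneratesSym ts) where

  private
    V : Set
    V = Fin (suc m)
    A B : Fin m → V
    A i = Transposition.a (ts i)
    B i = Transposition.b (ts i)

  Joins : Fin m → V → V → Set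
  Joins i v u = (A i ≡ v × B i ≡ u) ⊎ (B i ≡ v × A i ≡ u)

  Touches : Fin m → V → Set
  Touches i v = A i ≡ v ⊎ B i ≡ v

  Reachable : ℕ → V → Set
  Reachable zero    v = v ≡ zero
  Reachable (suc s) v = Reachable s v ⊎ (Σ[ i ∈ Fin m ] Σ[ u ∈ V ] (Joins i v u × Reachable s u))

  reachable? : ∀ s → Decidable (Reachable s)
  reachable? zero    v = v ≟ zero
  reachable? (suc s) v = reachable? s v ⊎-dec any? λ i → any? λ u → joins? i u ×-dec reachable? s u
    where
    joins? : ∀ i u → Dec (Joins i v u)
    joins? i u = (A i ≟ v ×-dec B i ≟ u) ⊎-dec (B i ≟ v ×-dec A i ≟ u)

  reachable-τ : ∀ {s x} i → Reachable s x → Reachable (suc s) (τ (A i) (B i) x)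
  reachable-τ {x = x} i reach with position (A i) (B i) x
  ... | at-a              rewrite τ-left (A i) (B i)  = inj₂ (i , A i , inj₂ (refl , refl) , reach)
  ... | at-b _            rewrite τ-right (A i) (B i) = inj₂ (i , B i , inj₁ (refl , refl) , reach)
  ... | elsewhere x≢a x≢b rewrite τ-other x≢a x≢b    = inj₁ reach

  reachable-evalWord : ∀ w → Reachable (length w) (evalWord ts w zero)
  reachable-evalWord []      = refl
  reachable-evalWord (i ∷ w) = reachable-τ i (reachable-evalWord w)

  connected : ∀ v → Σ[ s ∈ ℕ ] Reachable s v
  connected v with gen (transpose zero v)
  ... | w , w≗τ = length w , subst (Reachable (length w)) (trans (w≗τ zero) (τ-left zero v)) (reachable-evalWord w)

  closest : ∀ v → Σ[ s ∈ ℕ ] (Reachable s v × (∀ {t} → t < s → ¬ Reachable t v))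
  closest v = least-witness (λ s → reachable? s v) (proj₂ (connected v))

  dist : V → ℕ
  dist v = proj₁ (closest v)

  dist-minimal : ∀ {s v} → Reachable s v → dist v ≤ s
  dist-minimal {v = v} reach = ℕ.≮⇒≥ λ s<dist → proj₂ (proj₂ (closest v)) s<dist reach

  parent : ∀ k → Σ[ i ∈ Fin m ] Σ[ u ∈ V ] (Joins i (suc k) u × dist u < dist (suc k))
  parent k = step (dist (suc k)) (proj₁ (proj₂ (closest (suc k)))) (proj₂ (proj₂ (closest (suc k))))
    where
    step : ∀ s → Reachable s (suc k) → (∀ {t} → t < s → ¬ Reachable t (suc k)) → Σ[ i ∈ Fin m ] Σ[ u ∈ V ] (Joins i (suc k) u × dist u < s)
    step zero    ()                            _
    step (suc s) (inj₁ reach)                   minimal = ⊥-elim (minimal (ℕ.n<1+n s) reach)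
    step (suc s) (inj₂ (i , u , joins , reach)) _       = i , u , joins , s≤s (dist-minimal reach)

  parentEdge : Fin m → Fin m
  parentEdge k = proj₁ (parent k)

  parentVertex : Fin m → V
  parentVertex k = proj₁ (proj₂ (parent k))

  joins-parent : ∀ k → Joins (parentEdge k) (suc k) (parentVertex k)
  joins-parent k = proj₁ (proj₂ (proj₂ (parent k)))

  parent-closer : ∀ k → dist (parentVertex k) < dist (suc k)
  parent-closer k = proj₂ (proj₂ (proj₂ (parent k)))

  joins-other : ∀ {i v u w} → Joins i v u → Touches i w → w ≢ v → w ≡ u
  joins-other (inj₁ (refl , refl)) (inj₁ refl) w≢v = ⊥-elim (w≢v refl)
  joins-other (inj₁ (refl , refl)) (inj₂ refl) w≢v = refl
  joins-other (inj₂ (refl , refl)) (inj₁ refl) w≢v = refl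
  joins-other (inj₂ (refl , refl)) (inj₂ refl) w≢v = ⊥-elim (w≢v refl)

  joins-touches : ∀ {i v u} → Joins i v u → Touches i v
  joins-touches (inj₁ (A≡v , _)) = inj₁ A≡v
  joins-touches (inj₂ (B≡v , _)) = inj₂ B≡v

  parentEdge-injective : ∀ {k k′} → parentEdge k ≡ parentEdge k′ → k ≡ k′
  parentEdge-injective {k} {k′} same with suc k ≟ suc k′
  ... | yes 1+k≡1+k′ = suc-injective 1+k≡1+k′
  ... | no 1+k≢1+k′  = ⊥-elim (ℕ.<-asym (farther k k′ 1+k≢1+k′ (sym same)) (farther k′ k (1+k≢1+k′ ∘ sym) same))
    where
    farther : ∀ k k′ → suc k ≢ suc k′ → parentEdge k′ ≡ parentEdge k → dist (suc k) < dist (suc k′)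
    farther k k′ 1+k≢1+k′ same = subst (λ v → dist v < dist (suc k′)) (sym 1+k≡parent) (parent-closer k′)
      where
      1+k≡parent : suc k ≡ parentVertex k′
      1+k≡parent = joins-other (subst (λ i → Joins i (suc k′) (parentVertex k′)) same (joins-parent k′))
                               (joins-touches (joins-parent k)) 1+k≢1+k′

  root-at-joint : ∀ {i v u} → Joins i v u → root (ts i) v * root (ts i) v ≡ 1ℤ
  root-at-joint {i} (inj₁ (refl , _)) rewrite e-diagonal (A i) | e-offDiagonal (Transposition.a≢b (ts i) ∘ sym) = refl
  root-at-joint {i} (inj₂ (refl , _)) rewrite e-diagonal (B i) | e-offDiagonal (Transposition.a≢b (ts i)) = refl

  root-away : ∀ {i v} → ¬ Touches i v → root (ts i) v ≡ 0ℤ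
  root-away ¬touches = cong₂ _-_ (e-offDiagonal (¬touches ∘ inj₁)) (e-offDiagonal (¬touches ∘ inj₂))

  lone-coefficient : (c : Fin m → ℤ) {i : Fin m} {v u : V} → Σℤ (λ j → c j * root (ts j) v) ≡ 0ℤ → Joins i v u →
                     (∀ j → j ≢ i → Touches j v → c j ≡ 0ℤ) → c i ≡ 0ℤ
  lone-coefficient c {i} {v} Σ≡0 joins others =
    unit-cancel (root-at-joint joins) (trans (sym (Σℤ-single _ i vanish)) Σ≡0)
    where
    vanish : ∀ j → j ≢ i → c j * root (ts j) v ≡ 0ℤ
    vanish j j≢i = by-touching ((A j ≟ v) ⊎-dec (B j ≟ v))
      where
      by-touching : Dec (Touches j v) → c j * root (ts j) v ≡ 0ℤ
      by-touching (yes touches) = trans (cong (_* root (ts j) v) (others j j≢i touches)) (ℤ.*-zeroˡ (root (ts j) v))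
      by-touching (no ¬touches) = trans (cong (c j *_) (root-away ¬touches)) (ℤ.*-zeroʳ (c j))

  -- Induction from the far end of the tree: at vertex k+1 every edge other than its parent edge
  -- is the parent edge of a farther vertex, so coordinate k+1 of a dependency isolates c (parentEdge k).
  generatesSym⇒linIndep : LinIndep (root ∘ ts)
  generatesSym⇒linIndep c Σ≡0 i with injective⇒surjective parentEdge parentEdge-injective i
  ... | k , refl = parent-zero k (<-wellFounded (height k))
    where
    height : Fin m → ℕ
    height k = proj₁ (bounded dist) ∸ dist (suc k)
    parent-zero : ∀ k → Acc _<_ (height k) → c (parentEdge k) ≡ 0ℤ
    parent-zero k (acc rec) = lone-coefficient c (Σ≡0 (suc k)) (joins-parent k) others
      where
      others : ∀ j → j ≢ parentEdge k → Touches j (suc k) → c j ≡ 0ℤ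
      others j j≢ touches with injective⇒surjective parentEdge parentEdge-injective j
      ... | k′ , refl = parent-zero k′ (rec (ℕ.∸-monoʳ-< closer (proj₂ (bounded dist) (suc k′))))
        where
        1+k≡parent : suc k ≡ parentVertex k′
        1+k≡parent = joins-other (joins-parent k′) touches (j≢ ∘ sym ∘ cong parentEdge ∘ suc-injective)
        closer : dist (suc k) < dist (suc k′)
        closer = subst (λ v → dist v < dist (suc k′)) (sym 1+k≡parent) (parent-closer k′)

proposition2p14 : (n : ℕ) → 1 ≤ n → (G : Fin n → Fin n → ℕ) →
                    CarterDiagramA n G ⇔ InAnn n G
proposition2p14 n 1≤n G = mk⇔ carter⇒ann ann⇒carter
  where
  carter⇒ann : CarterDiagramA n G → InAnn n G
  carter⇒ann (β , β-roots , β-linIndep , β-generates , carter) =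
    ts , generatesΦ⇒generatesSym ts β β≗root β-generates ,
    Equivalence.to (carter⇔kluitmann β ts β≗root β-linIndep G) carter
    where
    ts : Fin n → Transposition (suc n)
    ts = transposition ∘ β-roots
    β≗root : ∀ i → β i ≗ root (ts i)
    β≗root = ≗root-transposition ∘ β-roots

  ann⇒carter : InAnn n G → CarterDiagramA n G
  ann⇒carter (ts , ts-generate , kluitmann) =
    root ∘ ts , root-isRoot ∘ ts , linIndep , generatesSym⇒generatesΦ ts (fromℕ< 1≤n) ts-generate ,
    Equivalence.from (carter⇔kluitmann (root ∘ ts) ts (λ _ _ → refl) linIndep G) kluitmann
    where
    linIndep : LinIndep (root ∘ ts)
    linIndep = generatesSym⇒linIndep ts ts-generate
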